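{- Let $w\in\{a,b\}^*$ with $l(w)\ge 9$. Then there exists an element of $\mathtt{BR}(w)$ that is not rich.
   Context: For a non-empty word, its run-length encoding is $c_1^{n_1}\cdots c_k^{n_k}$ with letters $c_i\ne c_{i+1}$ and $n_i\ge1$; $l(w)=k$ is the length of its run sequence. $\mathtt{BR}(w)=\{B_t\cdots B_1 : w=B_1\cdots B_t,\ t\ge1,\ B_i \text{ non-empty}\}$. A word $w$ is rich if it has exactly $|w|$ distinct non-empty palindromic factors. -}

module Defs where

open import Data.Nat using (ℕ; zero; suc)
open import Data.Product using (Σ; ∃; _×_; _,_)
open import Data.List using (List; []; _∷_; _++_; length; concat; reverse)
open import Data.List.Relation.Unary.All using (All)
open import Data.List.Relation.Unary.Unique.Propositional using (Unique)
open import Data.List.Membership.Propositional using (_∈_)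
open import Relation.Binary.PropositionalEquality using (_≡_)
open import Relation.Nullary using (¬_; yes; no)
open import Function.Bundles using (_⇔_)

data Letter : Set where
  a b : Letter

_≟L_ : (x y : Letter) → Relation.Nullary.Dec (x ≡ y)
a ≟L a = yes _≡_.refl
a ≟L b = no (λ ())
b ≟L a = no (λ ())
b ≟L b = yes _≡_.refl

Word : Set
Word = List Letter

rle : Word → List (Letter × ℕ)
rle [] = []
rle (x ∷ w) with rle w
... | [] = (x , 1) ∷ []
... | (c , n) ∷ rs with x ≟L c
...   | yes _ = (c , suc n) ∷ rs
...   | no _  = (x , 1) ∷ (c , n) ∷ rs

l : Word → ℕ
l w = length (rle w)

NonEmpty : Word → Set
NonEmpty u = ¬ (u ≡ [])

_∈BR_ : Word → Word → Set
v ∈BR w = Σ (List Word) λ Bs →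
  ¬ (Bs ≡ []) × All NonEmpty Bs × concat Bs ≡ w × v ≡ concat (reverse Bs)

Factor : Word → Word → Set
Factor u w = Σ Word λ p → Σ Word λ s → p ++ u ++ s ≡ w

Palindrome : Word → Set
Palindrome u = reverse u ≡ u

-- w is rich: it has exactly |w| distinct non-empty palindromic factors,
-- i.e. there is a duplicate-free list of exactly these factors of length |w|.
Rich : Word → Set
Rich w = Σ (List Word) λ L →
  Unique L × (∀ u → (u ∈ L) ⇔ (NonEmpty u × Factor u w × Palindrome u))
  × length L ≡ length w

-- Prepending a letter x to a word t creates at most one new palindromic factor, the longest
-- palindromic prefix of x t: every shorter palindromic prefix is a proper suffix of it, hence
-- occurs in t.  So a word has at most |w| palindromic factors, and strictly fewer when it
-- contains a factor x t all of whose palindromic prefixes occur in t (on the right, words are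
-- extended through reversal).
-- A word with nine runs is  c^(1+n₀) d^(1+n₁) c^(1+n₂) ⋯ d^(1+n₇) c X.  Reversing the blocks
--   c^(1+n₀) d^n₁ | d c^(1+n₂) | d^(1+n₃) c | c^n₄ d^(1+n₅) | c^(1+n₆) | d^(1+n₇) c | X
-- yields a word containing  c c d^(n₅+n₃+2) c d c c.  Its palindromic prefixes c and c c occur
-- again later in it, and it has no longer palindromic prefix because c c occurs in it only at
-- its two ends.
module Submission where

open import Defs
open import Data.Nat using (ℕ; zero; suc; _+_; _≤_; _<_; z≤n; s≤s)
open import Data.Nat.Properties
  using (≤-pred; ≤∧≢⇒<; <⇒≤; <⇒≱; <-irrefl; m≤n⇒m<n∨m≡n; ⊓-glb; +-suc; +-comm; +-identityʳ; +-monoʳ-<; n<1+n; module ≤-Reasoning)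
open import Data.Product using (Σ; ∃; ∃₂; _×_; _,_)
open import Data.Sum using (_⊎_; inj₁; inj₂)
open import Data.Empty using (⊥-elim)
open import Data.List using (List; []; _∷_; [_]; _++_; length; replicate; reverse; map; take; drop; concat)
open import Data.List.Properties
  using (++-assoc; ++-identityʳ; ++-conicalˡ; ++-conicalʳ; ∷-injective; ∷-injectiveˡ; ∷-injectiveʳ; ≡-dec; take++drop≡id;
         length-take; length-++; length-++-≤ˡ; length-map; length-reverse; reverse-++; reverse-involutive;
         unfold-reverse; foldr-fusion; concat-++)
open import Data.List.Membership.Propositional using (_∈_)
open import Data.List.Membership.Propositional.Properties using (∈-map⁺)
open import Data.List.Relation.Unary.Any using (here; there)
open import Data.List.Relation.Unary.All using (All; []; _∷_; lookup)
open import Data.List.Relation.Unary.All.Properties using (++⁺)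
open import Data.List.Relation.Unary.AllPairs using (_∷_)
open import Data.List.Relation.Unary.Unique.Propositional using (Unique)
open import Data.List.Relation.Binary.Subset.Propositional using (_⊆_)
open import Function.Bundles using (Equivalence)
open import Relation.Binary.PropositionalEquality using (_≡_; _≢_; refl; sym; trans; cong; cong₂; subst; subst₂; module ≡-Reasoning)
open import Relation.Nullary using (¬_; Dec; yes; no)

++-∷≢[] : ∀ {A : Set} (xs : List A) {y ys} → xs ++ y ∷ ys ≢ []
++-∷≢[] xs e with ++-conicalʳ xs _ e
... | ()

infix 8 _^_
_^_ : Letter → ℕ → Word
x ^ n = replicate n x

^-++-∷ : ∀ x n w → x ^ n ++ x ∷ w ≡ x ∷ x ^ n ++ w
^-++-∷ x zero    w = refl
^-++-∷ x (suc n) w = cong (x ∷_) (^-++-∷ x n w)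

^-++-^ : ∀ x m n w → x ^ m ++ x ^ n ++ w ≡ x ^ (m + n) ++ w
^-++-^ x zero    n w = refl
^-++-^ x (suc m) n w = cong (x ∷_) (^-++-^ x m n w)

other : Letter → Letter
other a = b
other b = a

other-involutive : ∀ x → other (other x) ≡ x
other-involutive a = refl
other-involutive b = refl

≢-other : ∀ x → x ≢ other x
≢-other a ()
≢-other b ()

≢⇒≡other : ∀ {x y} → x ≢ y → y ≡ other x
≢⇒≡other {a} {a} x≢y = ⊥-elim (x≢y refl)
≢⇒≡other {a} {b} _   = refl
≢⇒≡other {b} {a} _   = refl
≢⇒≡other {b} {b} x≢y = ⊥-elim (x≢y refl)

rle-∷ : ∀ x w → ∃₂ λ n rs → rle (x ∷ w) ≡ (x , n) ∷ rs
rle-∷ x w with rle w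
... | [] = 1 , [] , refl
... | (y , n) ∷ rs with x ≟L y
...   | yes refl = suc n , rs , refl
...   | no _     = 1 , (y , n) ∷ rs , refl

l-∷-≡ : ∀ x w → l (x ∷ x ∷ w) ≡ l (x ∷ w)
l-∷-≡ x w with rle (x ∷ w) | rle-∷ x w
... | .((x , n) ∷ rs) | n , rs , refl with x ≟L x
...   | yes _   = refl
...   | no x≢x = ⊥-elim (x≢x refl)

l-∷-≢ : ∀ {x y} w → x ≢ y → l (x ∷ y ∷ w) ≡ suc (l (y ∷ w))
l-∷-≢ {x} {y} w x≢y with rle (y ∷ w) | rle-∷ y w
... | .((y , n) ∷ rs) | n , rs , refl with x ≟L y
...   | yes x≡y = ⊥-elim (x≢y x≡y)
...   | no _    = refl

firstRun : ∀ x w → ∃₂ λ n w′ → x ∷ w ≡ x ^ suc n ++ w′ × l (x ∷ w) ≡ suc (l w′)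
                              × (w′ ≡ [] ⊎ ∃ λ X → w′ ≡ other x ∷ X)
firstRun x [] = 0 , [] , refl , refl , inj₁ refl
firstRun x (y ∷ w) with x ≟L y
... | yes refl =
  let n , w′ , split , length≡ , next = firstRun x w
  in suc n , w′ , cong (x ∷_) split , trans (l-∷-≡ x w) length≡ , next
... | no x≢y = 0 , y ∷ w , refl , l-∷-≢ w x≢y , inj₂ (w , cong (_∷ w) (≢⇒≡other x≢y))

Runs : ℕ → Letter → Letter → Word → Set
Runs zero    c d w = ∃ λ X → w ≡ c ∷ X
Runs (suc k) c d w = ∃₂ λ n w′ → w ≡ c ^ suc n ++ w′ × Runs k d c w′

runs : ∀ k x X → suc k ≤ l (x ∷ X) → Runs k x (other x) (x ∷ X)
runs zero    x X _ = X , refl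
runs (suc k) x X k<l with firstRun x X
... | n , w′ , split , length≡ , next with next | ≤-pred (subst (suc (suc k) ≤_) length≡ k<l)
...   | inj₁ refl       | ()
...   | inj₂ (Y , refl) | k<l′ =
  n , other x ∷ Y , split ,
  subst (λ y → Runs k (other x) y (other x ∷ Y)) (other-involutive x) (runs k (other x) Y k<l′)

Prefix : Word → Word → Set
Prefix u w = ∃ λ s → u ++ s ≡ w

PalFactor : Word → Word → Set
PalFactor u w = NonEmpty u × Factor u w × Palindrome u

PalCover : List Word → Word → Set
PalCover C w = ∀ {u} → PalFactor u w → u ∈ C

remove : ∀ {A : Set} {y : A} {C} → y ∈ C →
         ∃ λ C′ → length C ≡ suc (length C′) × (∀ {z} → z ∈ C → z ≢ y → z ∈ C′)
remove {C = _ ∷ C} (here refl) =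
  C , refl , λ { (here refl) z≢y → ⊥-elim (z≢y refl) ; (there z∈C) _ → z∈C }
remove {C = x ∷ _} (there y∈C) =
  let C′ , length≡ , keep = remove y∈C
  in x ∷ C′ , cong suc length≡ , λ { (here refl) _ → here refl ; (there z∈C) z≢y → there (keep z∈C z≢y) }

Unique-⊆⇒length≤ : ∀ {A : Set} {L C : List A} → Unique L → L ⊆ C → length L ≤ length C
Unique-⊆⇒length≤ {L = []} _ _ = z≤n
Unique-⊆⇒length≤ {L = y ∷ L} (y∉L ∷ unique) L⊆C =
  let C′ , length≡ , keep = remove (L⊆C (here refl))
  in subst (suc (length L) ≤_) (sym length≡)
       (s≤s (Unique-⊆⇒length≤ unique λ u∈L → keep (L⊆C (there u∈L)) (λ u≡y → lookup y∉L u∈L (sym u≡y))))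

¬Rich-if-smallPalCover : ∀ {C v} → PalCover C v → length C < length v → ¬ Rich v
¬Rich-if-smallPalCover cover C<v (L , unique , L↔palFactors , length≡) =
  <⇒≱ C<v (subst (_≤ _) length≡ (Unique-⊆⇒length≤ unique λ {u} u∈L → cover (Equivalence.to (L↔palFactors u) u∈L)))

palindrome? : ∀ u → Dec (Palindrome u)
palindrome? u = ≡-dec _≟L_ (reverse u) u

prefix-take : ∀ {u w n} → Prefix u w → length u ≡ n → take n w ≡ u
prefix-take {[]}    _          refl = refl
prefix-take {x ∷ u} (s , refl) refl = cong (x ∷_) (prefix-take (s , refl) refl)

prefix⇒length≤ : ∀ {u w} → Prefix u w → length u ≤ length w
prefix⇒length≤ {u} (_ , refl) = length-++-≤ˡ u

≤-prefix : ∀ {u L w} → Prefix u w → Prefix L w → length u ≤ length L → Prefix u L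
≤-prefix {[]}    {L} _ _ _ = L , refl
≤-prefix {x ∷ u} {y ∷ L} (s , refl) (S , e) (s≤s u≤L) with ∷-injective e
... | refl , e′ = let q , uq≡L = ≤-prefix (s , refl) (S , e′) u≤L in q , cong (x ∷_) uq≡L

longestPalPrefixUpTo : ∀ k w → ∃ λ L → Palindrome L × Prefix L w
                       × (∀ {u} → Palindrome u → Prefix u w → length u ≤ k → length u ≤ length L)
longestPalPrefixUpTo zero    w = [] , refl , (w , refl) , λ _ _ u≤0 → u≤0
longestPalPrefixUpTo (suc k) w with palindrome? (take (suc k) w)
... | yes palT =
  take (suc k) w , palT , (drop (suc k) w , take++drop≡id (suc k) w) ,
  λ {u} _ u≼w u≤1+k → subst (length u ≤_) (sym (length-take (suc k) w)) (⊓-glb u≤1+k (prefix⇒length≤ u≼w))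
... | no ¬palT =
  let L , palL , L≼w , longest = longestPalPrefixUpTo k w
  in L , palL , L≼w , λ palu u≼w u≤1+k →
       longest palu u≼w (≤-pred (≤∧≢⇒< u≤1+k λ u≡1+k →
         ¬palT (subst Palindrome (sym (prefix-take u≼w u≡1+k)) palu)))

longestPalPrefix : ∀ w → ∃ λ L → Palindrome L × Prefix L w
                   × (∀ {u} → Palindrome u → Prefix u w → length u ≤ length L)
longestPalPrefix w =
  let L , palL , L≼w , longest = longestPalPrefixUpTo (length w) w
  in L , palL , L≼w , λ palu u≼w → longest palu u≼w (prefix⇒length≤ u≼w)

factor-∷ : ∀ {u x t} → Factor u (x ∷ t) → Prefix u (x ∷ t) ⊎ Factor u t
factor-∷ ([]    , s , e) = inj₁ (s , e)
factor-∷ (_ ∷ p , s , e) = inj₂ (p , s , ∷-injectiveʳ e)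

properSuffix⇒factor : ∀ {x t u L S} R → L ≡ R ++ u → length u < length L → L ++ S ≡ x ∷ t → Factor u t
properSuffix⇒factor []      refl u<u _ = ⊥-elim (<-irrefl refl u<u)
properSuffix⇒factor {u = u} {S = S} (_ ∷ R) refl _ e = R , S , trans (sym (++-assoc R u S)) (∷-injectiveʳ e)

shorterPalPrefix⇒factor : ∀ {x t u L} → Palindrome u → Palindrome L → Prefix u (x ∷ t) → Prefix L (x ∷ t)
                          → length u < length L → Factor u t
shorterPalPrefix⇒factor {u = u} {L} palu palL u≼ L≼@(_ , LS≡) u<L with ≤-prefix u≼ L≼ (<⇒≤ u<L)
... | q , uq≡L = properSuffix⇒factor (reverse q) L≡ u<L LS≡
  where
  open ≡-Reasoning
  L≡ : L ≡ reverse q ++ u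
  L≡ = begin
    L                      ≡⟨ sym palL ⟩
    reverse L              ≡⟨ cong reverse (sym uq≡L) ⟩
    reverse (u ++ q)       ≡⟨ reverse-++ u q ⟩
    reverse q ++ reverse u ≡⟨ cong (reverse q ++_) palu ⟩
    reverse q ++ u         ∎

palCover-∷ : ∀ {C t} x → PalCover C t → ∃ λ D → PalCover (D ∷ C) (x ∷ t)
palCover-∷ {C} {t} x cover with longestPalPrefix (x ∷ t)
... | L , palL , L≼ , longest = L , cover′
  where
  cover′ : PalCover (L ∷ C) (x ∷ t)
  cover′ (ne , u∈ , palu) with factor-∷ u∈
  ... | inj₂ u∈t = there (cover (ne , u∈t , palu))
  ... | inj₁ u≼ with m≤n⇒m<n∨m≡n (longest palu u≼)
  ...   | inj₁ u<L = there (cover (ne , shorterPalPrefix⇒factor palu palL u≼ L≼ u<L , palu))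
  ...   | inj₂ u≡L = here (trans (sym (prefix-take u≼ u≡L)) (prefix-take L≼ refl))

palCover-[] : PalCover [] []
palCover-[] (ne , (p , s , e) , _) = ⊥-elim (ne (++-conicalˡ _ s (++-conicalʳ p _ e)))

palCover-++ˡ : ∀ {C t} p → PalCover C t → ∃ λ D → PalCover D (p ++ t) × length D ≡ length p + length C
palCover-++ˡ []      cover = _ , cover , refl
palCover-++ˡ (x ∷ p) cover =
  let D , coverD , length≡ = palCover-++ˡ p cover
      L , coverLD = palCover-∷ x coverD
  in L ∷ D , coverLD , cong suc length≡

palCover-length : ∀ w → ∃ λ C → PalCover C w × length C ≡ length w
palCover-length w =
  let C , cover , length≡ = palCover-++ˡ w palCover-[]
  in C , subst (PalCover C) (++-identityʳ w) cover , trans length≡ (+-identityʳ (length w))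

Factor-reverse : ∀ {u w} → Factor u w → Factor (reverse u) (reverse w)
Factor-reverse {u} (p , s , refl) = reverse s , reverse p , (begin
  reverse s ++ reverse u ++ reverse p   ≡⟨ sym (++-assoc (reverse s) (reverse u) (reverse p)) ⟩
  (reverse s ++ reverse u) ++ reverse p ≡⟨ cong (_++ reverse p) (sym (reverse-++ u s)) ⟩
  reverse (u ++ s) ++ reverse p         ≡⟨ sym (reverse-++ p (u ++ s)) ⟩
  reverse (p ++ u ++ s)                 ∎)
  where open ≡-Reasoning

palCover-reverse : ∀ {C w} → PalCover C w → PalCover (map reverse C) (reverse w)
palCover-reverse {C} {w} cover {u} (ne , u∈ , palu) =
  subst (_∈ map reverse C) palu (∈-map⁺ reverse (cover (ne , u∈w , palu)))
  where
  u∈w : Factor u w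
  u∈w = subst₂ Factor palu (reverse-involutive w) (Factor-reverse u∈)

palCover-++ʳ : ∀ {C t} s → PalCover C t → ∃ λ D → PalCover D (t ++ s) × length D ≡ length C + length s
palCover-++ʳ {C} {t} s cover =
  let D , coverD , length≡ = palCover-++ˡ (reverse s) (palCover-reverse cover)
  in map reverse D , subst (PalCover (map reverse D)) reverse-reverse-++ (palCover-reverse coverD) , (begin
       length (map reverse D)                      ≡⟨ length-map reverse D ⟩
       length D                                    ≡⟨ length≡ ⟩
       length (reverse s) + length (map reverse C) ≡⟨ cong₂ _+_ (length-reverse s) (length-map reverse C) ⟩
       length s + length C                         ≡⟨ +-comm (length s) (length C) ⟩
       length C + length s                         ∎)
  where
  open ≡-Reasoning
  reverse-reverse-++ : reverse (reverse s ++ reverse t) ≡ t ++ s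
  reverse-reverse-++ = begin
    reverse (reverse s ++ reverse t)             ≡⟨ reverse-++ (reverse s) (reverse t) ⟩
    reverse (reverse t) ++ reverse (reverse s)   ≡⟨ cong₂ _++_ (reverse-involutive t) (reverse-involutive s) ⟩
    t ++ s                                       ∎

palindrome-ends : ∀ {x y u s v} → Palindrome (x ∷ y ∷ u) → (x ∷ y ∷ u) ++ s ≡ v → reverse u ++ y ∷ x ∷ s ≡ v
palindrome-ends {x} {y} {u} {s} {v} pal e = begin
  reverse u ++ y ∷ x ∷ s         ≡⟨ sym (++-assoc (reverse u) (y ∷ x ∷ []) s) ⟩
  (reverse u ++ y ∷ x ∷ []) ++ s ≡⟨ cong (_++ s) (sym (reverse-++ (x ∷ y ∷ []) u)) ⟩
  reverse (x ∷ y ∷ u) ++ s       ≡⟨ cong (_++ s) pal ⟩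
  (x ∷ y ∷ u) ++ s               ≡⟨ e ⟩
  v                              ∎
  where open ≡-Reasoning

PalPrefixesInTail : Letter → Word → Set
PalPrefixesInTail x t = ∀ {u} → NonEmpty u → Palindrome u → Prefix u (x ∷ t) → Factor u t

palCover-∷-inTail : ∀ {C x t} → PalPrefixesInTail x t → PalCover C t → PalCover C (x ∷ t)
palCover-∷-inTail inTail cover (ne , u∈ , palu) with factor-∷ u∈
... | inj₁ u≼  = cover (ne , inTail ne palu u≼ , palu)
... | inj₂ u∈t = cover (ne , u∈t , palu)

¬Rich-if-factor : ∀ {x t v} → PalPrefixesInTail x t → Factor (x ∷ t) v → ¬ Rich v
¬Rich-if-factor {x} {t} inTail (p , s , refl) =
  let C , coverC , |C| = palCover-length t
      D , coverD , |D| = palCover-++ʳ s (palCover-∷-inTail inTail coverC)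
      E , coverE , |E| = palCover-++ˡ p coverD
  in ¬Rich-if-smallPalCover coverE (begin-strict
       length E                             ≡⟨ |E| ⟩
       length p + length D                  ≡⟨ cong (length p +_) (trans |D| (cong (_+ length s) |C|)) ⟩
       length p + (length t + length s)     <⟨ +-monoʳ-< (length p) (n<1+n _) ⟩
       length p + suc (length t + length s) ≡⟨ cong (λ n → length p + suc n) (sym (length-++ t)) ⟩
       length p + length ((x ∷ t) ++ s)     ≡⟨ sym (length-++ p) ⟩
       length (p ++ (x ∷ t) ++ s)           ∎)
  where open ≤-Reasoning

∈BR-++ : ∀ {v w} X → v ∈BR w → (X ++ v) ∈BR (w ++ X)
∈BR-++ {v} {w} [] v∈BRw = subst (v ∈BR_) (sym (++-identityʳ w)) v∈BRw
∈BR-++ X@(_ ∷ _) (Bs , _ , nonEmpty , refl , refl) =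
  Bs ++ [ X ] , ++-∷≢[] Bs , ++⁺ nonEmpty ((λ ()) ∷ []) ,
  trans (sym (concat-++ Bs [ X ])) (cong (concat Bs ++_) (++-identityʳ X)) ,
  cong concat (sym (reverse-++ Bs [ X ]))

Factor-++ˡ : ∀ {u v} X → Factor u v → Factor u (X ++ v)
Factor-++ˡ {u} X (p , s , refl) = X ++ p , s , ++-assoc X p (u ++ s)

module _ (c d : Letter) where

  cdᵏ⁺²cdcc : ℕ → Word
  cdᵏ⁺²cdcc k = c ∷ d ^ (2 + k) ++ c ∷ d ∷ c ∷ c ∷ []

  module _ (c≢d : c ≢ d) where

    cc-in-dⁿcdcc : ∀ n X {Y} → X ++ c ∷ c ∷ Y ≡ d ^ n ++ c ∷ d ∷ c ∷ c ∷ [] → Y ≡ []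
    cc-in-dⁿcdcc (suc n) []                  e = ⊥-elim (c≢d (∷-injectiveˡ e))
    cc-in-dⁿcdcc (suc n) (_ ∷ X)             e = cc-in-dⁿcdcc n X (∷-injectiveʳ e)
    cc-in-dⁿcdcc zero    []                  e = ⊥-elim (c≢d (∷-injectiveˡ (∷-injectiveʳ e)))
    cc-in-dⁿcdcc zero    (_ ∷ [])            e = ⊥-elim (c≢d (∷-injectiveˡ (∷-injectiveʳ e)))
    cc-in-dⁿcdcc zero    (_ ∷ _ ∷ [])        e = ∷-injectiveʳ (∷-injectiveʳ (∷-injectiveʳ (∷-injectiveʳ e)))
    cc-in-dⁿcdcc zero    (_ ∷ _ ∷ _ ∷ [])    ()
    cc-in-dⁿcdcc zero    (_ ∷ _ ∷ _ ∷ _ ∷ X) e =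
      ⊥-elim (++-∷≢[] X (∷-injectiveʳ (∷-injectiveʳ (∷-injectiveʳ (∷-injectiveʳ e)))))

    cc-in-ccdᵏ⁺²cdcc : ∀ k X {Y} → X ++ c ∷ c ∷ Y ≡ c ∷ cdᵏ⁺²cdcc k → X ≡ [] ⊎ Y ≡ []
    cc-in-ccdᵏ⁺²cdcc k []          e = inj₁ refl
    cc-in-ccdᵏ⁺²cdcc k (_ ∷ [])    e = ⊥-elim (c≢d (∷-injectiveˡ (∷-injectiveʳ (∷-injectiveʳ e))))
    cc-in-ccdᵏ⁺²cdcc k (_ ∷ _ ∷ X) e = inj₂ (cc-in-dⁿcdcc (2 + k) X (∷-injectiveʳ (∷-injectiveʳ e)))

    ccdᵏ⁺²cdcc-not-palindrome : ∀ k → ¬ Palindrome (c ∷ cdᵏ⁺²cdcc k)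
    ccdᵏ⁺²cdcc-not-palindrome k pal =
      c≢d (∷-injectiveˡ (∷-injectiveʳ (∷-injectiveʳ (∷-injectiveʳ
        (trans (sym (reverse-++ (c ∷ c ∷ d ^ (2 + k)) (c ∷ d ∷ c ∷ c ∷ []))) pal)))))

    ccdᵏ⁺²cdcc-palPrefixesInTail : ∀ k → PalPrefixesInTail c (cdᵏ⁺²cdcc k)
    ccdᵏ⁺²cdcc-palPrefixesInTail k {[]}         ne _ _ = ⊥-elim (ne refl)
    ccdᵏ⁺²cdcc-palPrefixesInTail k {_ ∷ []}     _  _ (_ , refl) = [] , _ , refl
    ccdᵏ⁺²cdcc-palPrefixesInTail k {_ ∷ _ ∷ []} _  _ (_ , refl) =
      c ∷ d ^ (2 + k) ++ c ∷ d ∷ [] , [] , cong (c ∷_) (++-assoc (d ^ (2 + k)) (c ∷ d ∷ []) (c ∷ c ∷ []))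
    ccdᵏ⁺²cdcc-palPrefixesInTail k {_ ∷ _ ∷ w ∷ u} _ palu (s , e) with ∷-injective e
    ... | refl , e′ with ∷-injectiveˡ e′
    ...   | refl with cc-in-ccdᵏ⁺²cdcc k (reverse (w ∷ u)) (palindrome-ends palu e)
    ...     | inj₁ r    = ⊥-elim (++-∷≢[] (reverse u) (trans (sym (unfold-reverse w u)) r))
    ...     | inj₂ refl = ⊥-elim (ccdᵏ⁺²cdcc-not-palindrome k (subst Palindrome (trans (sym (++-identityʳ _)) e) palu))

  module _ (n₀ n₁ n₂ n₃ n₄ n₅ n₆ n₇ : ℕ) where

    nineRuns : Word → Word
    nineRuns X = c ^ suc n₀ ++ d ^ suc n₁ ++ c ^ suc n₂ ++ d ^ suc n₃
              ++ c ^ suc n₄ ++ d ^ suc n₅ ++ c ^ suc n₆ ++ d ^ suc n₇ ++ c ∷ X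

    B₁ B₂ B₃ B₄ B₅ B₆ : Word
    B₁ = c ^ suc n₀ ++ d ^ n₁
    B₂ = d ∷ c ^ suc n₂
    B₃ = d ^ suc n₃ ++ [ c ]
    B₄ = c ^ n₄ ++ d ^ suc n₅
    B₅ = c ^ suc n₆
    B₆ = d ^ suc n₇ ++ [ c ]

    blocks : List Word
    blocks = B₁ ∷ B₂ ∷ B₃ ∷ B₄ ∷ B₅ ∷ B₆ ∷ []

    blocks-nonEmpty : All NonEmpty blocks
    blocks-nonEmpty = (λ ()) ∷ (λ ()) ∷ (λ ()) ∷ ++-∷≢[] (c ^ n₄) ∷ (λ ()) ∷ (λ ()) ∷ []

    concat-blocks : ∀ X → concat blocks ++ X ≡ nineRuns X
    concat-blocks X = begin
      concat blocks ++ X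
        ≡⟨ foldr-fusion (_++ X) {g = _++_} [] (λ u v → ++-assoc u v X) blocks ⟩
      B₁ ++ B₂ ++ B₃ ++ B₄ ++ B₅ ++ B₆ ++ X
        ≡⟨ cong (λ R → B₁ ++ B₂ ++ B₃ ++ B₄ ++ B₅ ++ R) (++-assoc (d ^ suc n₇) [ c ] X) ⟩
      B₁ ++ B₂ ++ B₃ ++ B₄ ++ c ^ suc n₆ ++ d ^ suc n₇ ++ c ∷ X
        ≡⟨ cong (λ R → B₁ ++ B₂ ++ B₃ ++ R) (++-assoc (c ^ n₄) (d ^ suc n₅) _) ⟩
      B₁ ++ B₂ ++ B₃ ++ c ^ n₄ ++ d ^ suc n₅ ++ c ^ suc n₆ ++ d ^ suc n₇ ++ c ∷ X
        ≡⟨ cong (λ R → B₁ ++ B₂ ++ R) (++-assoc (d ^ suc n₃) [ c ] _) ⟩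
      B₁ ++ d ∷ c ^ suc n₂ ++ d ^ suc n₃ ++ c ^ suc n₄ ++ d ^ suc n₅ ++ c ^ suc n₆ ++ d ^ suc n₇ ++ c ∷ X
        ≡⟨ ++-assoc (c ^ suc n₀) (d ^ n₁) _ ⟩
      c ^ suc n₀ ++ d ^ n₁ ++ d ∷ c ^ suc n₂ ++ d ^ suc n₃ ++ c ^ suc n₄ ++ d ^ suc n₅ ++ c ^ suc n₆ ++ d ^ suc n₇ ++ c ∷ X
        ≡⟨ cong (c ^ suc n₀ ++_) (^-++-∷ d n₁ _) ⟩
      nineRuns X ∎
      where open ≡-Reasoning

    reverse-blocks-factor : Factor (c ∷ cdᵏ⁺²cdcc (n₅ + n₃)) (concat (reverse blocks))
    reverse-blocks-factor = d ^ suc n₇ ++ c ^ (n₆ + n₄) , s , sym (begin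
      B₆ ++ B₅ ++ B₄ ++ B₃ ++ d ∷ c ∷ c ^ n₂ ++ c ∷ (c ^ n₀ ++ d ^ n₁) ++ []
        ≡⟨ cong (λ R → B₆ ++ B₅ ++ B₄ ++ B₃ ++ d ∷ c ∷ R) (^-++-∷ c n₂ _) ⟩
      B₆ ++ B₅ ++ B₄ ++ B₃ ++ d ∷ c ∷ c ∷ s
        ≡⟨ cong (λ R → B₆ ++ B₅ ++ B₄ ++ R) (++-assoc (d ^ suc n₃) [ c ] _) ⟩
      B₆ ++ B₅ ++ B₄ ++ d ^ suc n₃ ++ cdccs
        ≡⟨ cong (λ R → B₆ ++ B₅ ++ R) (++-assoc (c ^ n₄) (d ^ suc n₅) _) ⟩
      B₆ ++ B₅ ++ c ^ n₄ ++ d ^ suc n₅ ++ d ^ suc n₃ ++ cdccs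
        ≡⟨ cong (λ R → B₆ ++ B₅ ++ c ^ n₄ ++ R) (^-++-^ d (suc n₅) (suc n₃) cdccs) ⟩
      B₆ ++ B₅ ++ c ^ n₄ ++ d ^ (suc n₅ + suc n₃) ++ cdccs
        ≡⟨ cong (λ k → B₆ ++ B₅ ++ c ^ n₄ ++ d ^ suc k ++ cdccs) (+-suc n₅ n₃) ⟩
      B₆ ++ c ∷ c ^ n₆ ++ c ^ n₄ ++ T
        ≡⟨ cong (λ R → B₆ ++ c ∷ R) (^-++-^ c n₆ n₄ T) ⟩
      B₆ ++ c ∷ c ^ (n₆ + n₄) ++ T
        ≡⟨ ++-assoc (d ^ suc n₇) [ c ] _ ⟩
      d ^ suc n₇ ++ c ∷ c ∷ c ^ (n₆ + n₄) ++ T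
        ≡⟨ cong (λ R → d ^ suc n₇ ++ c ∷ R) (sym (^-++-∷ c (n₆ + n₄) T)) ⟩
      d ^ suc n₇ ++ c ∷ c ^ (n₆ + n₄) ++ c ∷ T
        ≡⟨ cong (d ^ suc n₇ ++_) (sym (^-++-∷ c (n₆ + n₄) (c ∷ T))) ⟩
      d ^ suc n₇ ++ c ^ (n₆ + n₄) ++ c ∷ c ∷ T
        ≡⟨ sym (++-assoc (d ^ suc n₇) (c ^ (n₆ + n₄)) _) ⟩
      (d ^ suc n₇ ++ c ^ (n₆ + n₄)) ++ c ∷ c ∷ T
        ≡⟨ cong (λ R → (d ^ suc n₇ ++ c ^ (n₆ + n₄)) ++ c ∷ c ∷ R) (sym (++-assoc (d ^ (2 + (n₅ + n₃))) _ s)) ⟩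
      (d ^ suc n₇ ++ c ^ (n₆ + n₄)) ++ (c ∷ cdᵏ⁺²cdcc (n₅ + n₃)) ++ s ∎)
      where
      open ≡-Reasoning
      s cdccs T : Word
      s = c ^ n₂ ++ (c ^ n₀ ++ d ^ n₁) ++ []
      cdccs = c ∷ d ∷ c ∷ c ∷ s
      T = d ^ (2 + (n₅ + n₃)) ++ cdccs

    nineRuns-reversal : ∀ X → ∃ λ v → v ∈BR nineRuns X × Factor (c ∷ cdᵏ⁺²cdcc (n₅ + n₃)) v
    nineRuns-reversal X =
      X ++ concat (reverse blocks) ,
      subst ((X ++ concat (reverse blocks)) ∈BR_) (concat-blocks X) (∈BR-++ X (blocks , (λ ()) , blocks-nonEmpty , refl , refl)) ,
      Factor-++ˡ X reverse-blocks-factor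

proposition4p4 : (w : Word) → 9 ≤ l w → Σ Word λ v → v ∈BR w × ¬ Rich v
proposition4p4 []      ()
proposition4p4 (x ∷ X) 9≤l with runs 8 x X 9≤l
... | n₀ , _ , refl , n₁ , _ , refl , n₂ , _ , refl , n₃ , _ , refl ,
      n₄ , _ , refl , n₅ , _ , refl , n₆ , _ , refl , n₇ , _ , refl , X′ , refl =
  let v , v∈BR , factor∈v = nineRuns-reversal x (other x) n₀ n₁ n₂ n₃ n₄ n₅ n₆ n₇ X′
  in v , v∈BR , ¬Rich-if-factor (ccdᵏ⁺²cdcc-palPrefixesInTail x (other x) (≢-other x) (n₅ + n₃)) factor∈v
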